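{- Let $c\in\mathbb{N}$, and let $F$ be a fan on at least $c^2+c+1$ vertices with centre $v_1$. Let $\mathcal{P},\mathcal{Q}$ be partitions of $F$ such that $\mathcal{P}$ is a tree-partition and $|P\cap Q|\leq c$ for all $P\in\mathcal{P}$ and $Q\in\mathcal{Q}$. Let $Q_1$ be the part of $\mathcal{Q}$ containing $v_1$. Then there exists a vertex $v_2\in V(F)\setminus\{v_1\}$ such that the part $Q_2$ of $\mathcal{Q}$ containing $v_2$ satisfies $Q_1\neq Q_2$.
   Context: All graphs are finite, simple and undirected. A vertex is dominant if it is adjacent to every other vertex. A graph $F$ is a fan if $F$ has a dominant vertex $v$, called the centre, such that $F-v$ is a path. A partition $\mathcal{P}$ of a graph $G$ is a partition of $V(G)$ into parts. $G/\mathcal{P}$ is the graph whose vertices are the non-empty parts of $\mathcal{P}$, with distinct parts $P_1,P_2$ adjacent iff some $v_1\in P_1$, $v_2\in P_2$ satisfy $v_1v_2\in E(G)$. $\mathcal{P}$ is a tree-partition if $G/\mathcal{P}$ is isomorphic to a subgraph of a tree. -}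

module Defs where

open import Level using (0ℓ)
open import Data.Nat using (ℕ; zero; suc; _+_; _*_; _≤_)
open import Data.Fin using (Fin; toℕ; _≟_)
open import Data.List using (List; []; _∷_; length; filter; allFin)
open import Data.Product using (Σ; ∃; _×_; _,_)
open import Data.Sum using (_⊎_)
open import Relation.Nullary using (¬_)
open import Relation.Nullary.Decidable using (_×-dec_)
open import Relation.Binary.PropositionalEquality using (_≡_; _≢_)

record Graph (n : ℕ) : Set₁ where
  field
    Adj   : Fin n → Fin n → Set
    sym   : ∀ {x y} → Adj x y → Adj y x
    irrefl : ∀ {x} → ¬ Adj x x
open Graph public

Dominant : ∀ {n} → Graph n → Fin n → Set
Dominant G v = ∀ w → w ≢ v → Adj G v w

IsPathAfterDeleting : ∀ {n} → Graph n → Fin n → Set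
IsPathAfterDeleting {n} G v =
  Σ ℕ λ m → (m + 1 ≡ n) × Σ (Fin m → Fin n) λ p →
    (∀ i → p i ≢ v) ×
    (∀ i j → p i ≡ p j → i ≡ j) ×
    (∀ i j → (Adj G (p i) (p j) → (suc (toℕ i) ≡ toℕ j ⊎ suc (toℕ j) ≡ toℕ i))
           × ((suc (toℕ i) ≡ toℕ j ⊎ suc (toℕ j) ≡ toℕ i) → Adj G (p i) (p j)))

IsFanWithCentre : ∀ {n} → Graph n → Fin n → Set
IsFanWithCentre G v = Dominant G v × IsPathAfterDeleting G v

-- A partition of V(G) = Fin n is given by a labelling of vertices by part
-- labels (there are at most n non-empty parts, so labels in Fin n suffice);
-- the parts are the non-empty fibres.
Partition : ℕ → Set
Partition n = Fin n → Fin n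

data Walk {k : ℕ} (T : Graph k) : Fin k → Fin k → Set where
  here : ∀ {x} → Walk T x x
  step : ∀ {x y z} → Adj T x y → Walk T y z → Walk T x z

Connected : ∀ {k} → Graph k → Set
Connected {k} T = ∀ (x y : Fin k) → Walk T x y

HasCycle : ∀ {k} → Graph k → Set
HasCycle {k} T =
  Σ ℕ λ m → Σ (Fin (3 + m) → Fin k) λ c →
    (∀ i j → c i ≡ c j → i ≡ j) ×
    (∀ i j → suc (toℕ i) ≡ toℕ j → Adj T (c i) (c j)) ×
    (∀ i j → toℕ i ≡ 2 + m → toℕ j ≡ 0 → Adj T (c i) (c j))

IsTree : ∀ {k} → Graph k → Set
IsTree {k} T = (1 ≤ k) × Connected T × ¬ HasCycle T

QuotAdj : ∀ {n} → Graph n → Partition n → Fin n → Fin n → Set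
QuotAdj G P a b = a ≢ b × ∃ λ x → ∃ λ y → P x ≡ a × P y ≡ b × Adj G x y

NonEmptyPart : ∀ {n} → Partition n → Fin n → Set
NonEmptyPart P a = ∃ λ x → P x ≡ a

-- P is a tree-partition: G/P is isomorphic to a subgraph of a tree, i.e.
-- there is a tree T and an injective map from the non-empty parts into V(T)
-- sending adjacent parts to adjacent vertices.
IsTreePartition : ∀ {n} → Graph n → Partition n → Set₁
IsTreePartition {n} G P =
  Σ ℕ λ k → Σ (Graph k) λ T → IsTree T × Σ (Fin n → Fin k) λ φ →
    (∀ a b → NonEmptyPart P a → NonEmptyPart P b → φ a ≡ φ b → a ≡ b) ×
    (∀ a b → QuotAdj G P a b → Adj T (φ a) (φ b))

interSize : ∀ {n} → Partition n → Partition n → Fin n → Fin n → ℕ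
interSize {n} P Q a b =
  length (filter (λ x → (P x ≟ a) ×-dec (Q x ≟ b)) (allFin n))

-- If 𝒬 had only the one part Q₁, then |P ∩ Q₁| ≤ c would say that every part of the
-- tree-partition 𝒫 has at most c vertices. A tree-partition admits no triangle meeting
-- three different parts (its image in G/𝒫 would be a 3-cycle of the tree), so a run of
-- consecutive path vertices avoiding the part P₁ of the centre stays inside one part
-- (consecutive path vertices and v₁ form a triangle). Hence each of c disjoint windows of
-- c + 1 consecutive path vertices meets P₁; with v₁ this puts c + 1 vertices into P₁ ∩ Q₁.
module Submission where

open import Defs
open import Data.Nat using (ℕ; zero; suc; _+_; _*_; _≤_; _<_; _≤?_; _<?_; s≤s; s≤s⁻¹)
open import Data.Nat.Properties hiding (_≟_)
open import Data.Fin using (Fin; toℕ; fromℕ<; _≟_) renaming (zero to fzero; suc to fsuc)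
open import Data.Fin.Properties using (any?; injective⇒≤; toℕ<n; toℕ-fromℕ<; toℕ-injective)
open import Data.List using (filter; allFin; lookup)
open import Data.List.Relation.Unary.Any using (index)
open import Data.List.Relation.Unary.Any.Properties using (lookup-index)
open import Data.List.Membership.Propositional.Properties using (∈-filter⁺; ∈-allFin)
open import Data.Product using (Σ; ∃; _×_; _,_; proj₁; proj₂)
open import Data.Sum using (inj₁)
open import Data.Empty using (⊥; ⊥-elim)
open import Function.Definitions using (Injective)
open import Relation.Binary.Definitions using (tri<; tri≈; tri>)
open import Relation.Nullary using (yes; no; contradiction)
open import Relation.Nullary.Decidable using (_×-dec_; ¬?; decidable-stable)
open import Relation.Binary.PropositionalEquality
  using (_≡_; _≢_; refl; trans; cong; subst; subst₂; ≢-sym; module ≡-Reasoning)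
  renaming (sym to ≡-sym)

module _ {n : ℕ} (P Q : Partition n) (a b : Fin n) where

  injection⇒≤interSize : ∀ {k} (g : Fin k → Fin n) → Injective _≡_ _≡_ g →
                         (∀ i → P (g i) ≡ a) → (∀ i → Q (g i) ≡ b) →
                         k ≤ interSize P Q a b
  injection⇒≤interSize g g-inj inP inQ = injective⇒≤ position-injective
    where
    inside? = λ x → (P x ≟ a) ×-dec (Q x ≟ b)
    L = filter inside? (allFin n)
    position = λ i → ∈-filter⁺ inside? (∈-allFin (g i)) (inP i , inQ i)
    position-injective : Injective _≡_ _≡_ (λ i → index (position i))
    position-injective {i} {j} e = g-inj (begin
      g i                           ≡⟨ lookup-index (position i) ⟩
      lookup L (index (position i)) ≡⟨ cong (lookup L) e ⟩
      lookup L (index (position j)) ≡⟨ ≡-sym (lookup-index (position j)) ⟩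
      g j                           ∎)
      where open ≡-Reasoning

treePartition⇒noRainbowTriangle :
  ∀ {n} (G : Graph n) (P : Partition n) → IsTreePartition G P →
  ∀ x y z → Adj G x y → Adj G y z → Adj G x z →
  P x ≢ P y → P y ≢ P z → P x ≢ P z → ⊥
treePartition⇒noRainbowTriangle G P (k , T , (_ , _ , acyclic) , φ , φ-inj , φ-adj)
  x y z xy yz xz x≢y y≢z x≢z = acyclic (0 , cycle , cycle-inj , cycle-adj , cycle-closes)
  where
  image-adj : ∀ {u w} → Adj G u w → P u ≢ P w → Adj T (φ (P u)) (φ (P w))
  image-adj {u} {w} uw u≢w = φ-adj (P u) (P w) (u≢w , u , w , refl , refl , uw)

  image-≢ : ∀ {u w} → P u ≢ P w → φ (P u) ≢ φ (P w)
  image-≢ {u} {w} u≢w e = u≢w (φ-inj (P u) (P w) (u , refl) (w , refl) e)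

  cycle : Fin 3 → Fin k
  cycle fzero               = φ (P x)
  cycle (fsuc fzero)        = φ (P y)
  cycle (fsuc (fsuc fzero)) = φ (P z)

  cycle-inj : ∀ i j → cycle i ≡ cycle j → i ≡ j
  cycle-inj fzero               fzero               _ = refl
  cycle-inj fzero               (fsuc fzero)        e = ⊥-elim (image-≢ x≢y e)
  cycle-inj fzero               (fsuc (fsuc fzero)) e = ⊥-elim (image-≢ x≢z e)
  cycle-inj (fsuc fzero)        fzero               e = ⊥-elim (image-≢ x≢y (≡-sym e))
  cycle-inj (fsuc fzero)        (fsuc fzero)        _ = refl
  cycle-inj (fsuc fzero)        (fsuc (fsuc fzero)) e = ⊥-elim (image-≢ y≢z e)
  cycle-inj (fsuc (fsuc fzero)) fzero               e = ⊥-elim (image-≢ x≢z (≡-sym e))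
  cycle-inj (fsuc (fsuc fzero)) (fsuc fzero)        e = ⊥-elim (image-≢ y≢z (≡-sym e))
  cycle-inj (fsuc (fsuc fzero)) (fsuc (fsuc fzero)) _ = refl

  cycle-adj : ∀ i j → suc (toℕ i) ≡ toℕ j → Adj T (cycle i) (cycle j)
  cycle-adj fzero        (fsuc fzero)        _ = image-adj xy x≢y
  cycle-adj (fsuc fzero) (fsuc (fsuc fzero)) _ = image-adj yz y≢z
  cycle-adj fzero               fzero               ()
  cycle-adj fzero               (fsuc (fsuc fzero)) ()
  cycle-adj (fsuc fzero)        fzero               ()
  cycle-adj (fsuc fzero)        (fsuc fzero)        ()
  cycle-adj (fsuc (fsuc fzero)) fzero               ()
  cycle-adj (fsuc (fsuc fzero)) (fsuc fzero)        ()
  cycle-adj (fsuc (fsuc fzero)) (fsuc (fsuc fzero)) ()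

  cycle-closes : ∀ i j → toℕ i ≡ 2 → toℕ j ≡ 0 → Adj T (cycle i) (cycle j)
  cycle-closes (fsuc (fsuc fzero)) fzero _ _ = sym T (image-adj xz x≢z)
  cycle-closes fzero               _        () _
  cycle-closes (fsuc fzero)        _        () _
  cycle-closes (fsuc (fsuc fzero)) (fsuc _) _  ()

module _ {n : ℕ} (G : Graph n) (P : Partition n) (tree : IsTreePartition G P) (v : Fin n) where

  run-avoiding-centrePart⇒monochromatic :
    ∀ (y : ℕ → Fin n) k →
    (∀ {i} → i < k → Adj G (y i) (y (suc i))) →
    (∀ {i} → i ≤ k → Adj G v (y i)) →
    (∀ {i} → i ≤ k → P (y i) ≢ P v) →
    ∀ {i} → i ≤ k → P (y i) ≡ P (y 0)
  run-avoiding-centrePart⇒monochromatic y k consecutive toCentre avoids {zero} _ = refl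
  run-avoiding-centrePart⇒monochromatic y k consecutive toCentre avoids {suc i} i<k
    with P (y (suc i)) ≟ P (y i)
  ... | yes same = trans same (run-avoiding-centrePart⇒monochromatic
                                 y k consecutive toCentre avoids (<⇒≤ i<k))
  ... | no differ = ⊥-elim (treePartition⇒noRainbowTriangle G P tree v (y i) (y (suc i))
                      (toCentre (<⇒≤ i<k)) (consecutive i<k) (toCentre i<k)
                      (≢-sym (avoids (<⇒≤ i<k))) (≢-sym differ) (≢-sym (avoids i<k)))

record NeighbourhoodPath {n} (G : Graph n) (v : Fin n) (m : ℕ) : Set where
  field
    vertex      : ℕ → Fin n
    injective   : ∀ {i j} → i < m → j < m → vertex i ≡ vertex j → i ≡ j
    ≢centre     : ∀ {i} → i < m → vertex i ≢ v
    consecutive : ∀ {i} → suc i < m → Adj G (vertex i) (vertex (suc i))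
    toCentre    : ∀ {i} → i < m → Adj G v (vertex i)

-- Indices past the end of the path are sent to the centre; only indices < m are ever used.
fan⇒neighbourhoodPath : ∀ {n} {G : Graph n} {v : Fin n} → IsFanWithCentre G v →
                        Σ ℕ λ m → (m + 1 ≡ n) × NeighbourhoodPath G v m
fan⇒neighbourhoodPath {n} {G} {v} (dominant , m , m+1≡n , p , p≢v , p-inj , p-adj) =
  m , m+1≡n , record
    { vertex      = vertex
    ; injective   = injective
    ; ≢centre     = ≢centre
    ; consecutive = consecutive
    ; toCentre    = λ i<m → dominant _ (≢centre i<m)
    }
  where
  vertex : ℕ → Fin n
  vertex i with i <? m
  ... | yes i<m = p (fromℕ< i<m)
  ... | no  _   = v

  vertex-< : ∀ {i} (i<m : i < m) → vertex i ≡ p (fromℕ< i<m)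
  vertex-< {i} i<m with i <? m
  ... | yes _   = refl
  ... | no  i≮m = contradiction i<m i≮m

  ≢centre : ∀ {i} → i < m → vertex i ≢ v
  ≢centre i<m e = p≢v (fromℕ< i<m) (trans (≡-sym (vertex-< i<m)) e)

  injective : ∀ {i j} → i < m → j < m → vertex i ≡ vertex j → i ≡ j
  injective {i} {j} i<m j<m e = begin
    i                     ≡⟨ ≡-sym (toℕ-fromℕ< i<m) ⟩
    toℕ (fromℕ< i<m)      ≡⟨ cong toℕ (p-inj _ _ (trans (≡-sym (vertex-< i<m))
                                                   (trans e (vertex-< j<m)))) ⟩
    toℕ (fromℕ< j<m)      ≡⟨ toℕ-fromℕ< j<m ⟩
    j                     ∎
    where open ≡-Reasoning

  consecutive : ∀ {i} → suc i < m → Adj G (vertex i) (vertex (suc i))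
  consecutive {i} si<m =
    subst₂ (Adj G) (≡-sym (vertex-< i<m)) (≡-sym (vertex-< si<m))
      (proj₂ (p-adj (fromℕ< i<m) (fromℕ< si<m))
        (inj₁ (trans (cong suc (toℕ-fromℕ< i<m)) (≡-sym (toℕ-fromℕ< si<m)))))
    where
    i<m = <-trans (n<1+n i) si<m

window-start : (c : ℕ) → ℕ → ℕ
window-start c w = w * suc c

windows-disjoint : ∀ c {w w'} → w < w' → window-start c w + c < window-start c w'
windows-disjoint c {w} w<w' =
  <-≤-trans (≤-reflexive (cong suc (+-comm (w * suc c) c))) (*-monoˡ-≤ (suc c) w<w')

last-window-fits : ∀ c {w m} → w < c → c * suc c ≤ m → window-start c w + c < m
last-window-fits c w<c c[c+1]≤m = <-≤-trans (windows-disjoint c w<c) c[c+1]≤m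

module _ {n c : ℕ} {G : Graph n} {v : Fin n} (P Q : Partition n) (b : Fin n)
         (tree : IsTreePartition G P)
         (Q-constant : ∀ x → Q x ≡ b)
         (small : ∀ a → interSize P Q a b ≤ c)
         {m : ℕ} (path : NeighbourhoodPath G v m) where

  open NeighbourhoodPath path

  window-meets-centrePart : ∀ s → s + c < m →
                            ∃ λ i → s ≤ i × i ≤ s + c × P (vertex i) ≡ P v
  window-meets-centrePart s s+c<m with any? (λ (t : Fin (suc c)) → P (vertex (s + toℕ t)) ≟ P v)
  ... | yes (t , inCentrePart) =
    s + toℕ t , m≤m+n s (toℕ t) , +-monoʳ-≤ s (s≤s⁻¹ (toℕ<n t)) , inCentrePart
  ... | no none = ⊥-elim (1+n≰n (≤-trans window-in-one-part (small (P (vertex s)))))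
    where
    in-path : ∀ {t} → t ≤ c → s + t < m
    in-path t≤c = ≤-<-trans (+-monoʳ-≤ s t≤c) s+c<m

    monochromatic : ∀ {t} → t ≤ c → P (vertex (s + t)) ≡ P (vertex (s + 0))
    monochromatic = run-avoiding-centrePart⇒monochromatic G P tree v (λ t → vertex (s + t)) c
      (λ {t} t<c → subst (λ u → Adj G (vertex (s + t)) (vertex u)) (≡-sym (+-suc s t))
                     (consecutive (subst (_< m) (+-suc s t) (in-path t<c))))
      (λ t≤c → toCentre (in-path t≤c))
      (λ {t} t≤c e → none (fromℕ< (s≤s t≤c) ,
                           subst (λ u → P (vertex (s + u)) ≡ P v) (≡-sym (toℕ-fromℕ< (s≤s t≤c))) e))

    window : Fin (suc c) → Fin n
    window t = vertex (s + toℕ t)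

    window-in-one-part : suc c ≤ interSize P Q (P (vertex s)) b
    window-in-one-part = injection⇒≤interSize P Q (P (vertex s)) b window
      (λ e → toℕ-injective (+-cancelˡ-≡ s _ _
               (injective (in-path (s≤s⁻¹ (toℕ<n _))) (in-path (s≤s⁻¹ (toℕ<n _))) e)))
      (λ t → trans (monochromatic (s≤s⁻¹ (toℕ<n t))) (cong (λ u → P (vertex u)) (+-identityʳ s)))
      (λ t → Q-constant (window t))

  neighbourhoodPath-short : m < c * suc c
  neighbourhoodPath-short with c * suc c ≤? m
  ... | no  m<c[c+1]  = ≰⇒> m<c[c+1]
  ... | yes c[c+1]≤m = ⊥-elim (1+n≰n (≤-trans centrePart-large (small (P v))))
    where
    start : Fin c → ℕ
    start w = window-start c (toℕ w)

    hit : ∀ w → ∃ λ i → start w ≤ i × i ≤ start w + c × P (vertex i) ≡ P v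
    hit w = window-meets-centrePart (start w) (last-window-fits c (toℕ<n w) c[c+1]≤m)

    hit-index : Fin c → ℕ
    hit-index w = proj₁ (hit w)

    hit-index<m : ∀ w → hit-index w < m
    hit-index<m w = ≤-<-trans (proj₁ (proj₂ (proj₂ (hit w))))
                              (last-window-fits c (toℕ<n w) c[c+1]≤m)

    hit-index-increasing : ∀ {w w'} → toℕ w < toℕ w' → hit-index w < hit-index w'
    hit-index-increasing {w} {w'} w<w' =
      ≤-<-trans (proj₁ (proj₂ (proj₂ (hit w))))
                (<-≤-trans (windows-disjoint c w<w') (proj₁ (proj₂ (hit w'))))

    hit-index-injective : Injective _≡_ _≡_ hit-index
    hit-index-injective {w} {w'} e with <-cmp (toℕ w) (toℕ w')
    ... | tri< w<w' _ _ = contradiction e (<⇒≢ (hit-index-increasing w<w'))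
    ... | tri≈ _ w≡w' _ = toℕ-injective w≡w'
    ... | tri> _ _ w>w' = contradiction (≡-sym e) (<⇒≢ (hit-index-increasing w>w'))

    centre-and-hits : Fin (suc c) → Fin n
    centre-and-hits fzero    = v
    centre-and-hits (fsuc w) = vertex (hit-index w)

    centre-and-hits-injective : Injective _≡_ _≡_ centre-and-hits
    centre-and-hits-injective {fzero}  {fzero}   _ = refl
    centre-and-hits-injective {fzero}  {fsuc w}  e = contradiction (≡-sym e) (≢centre (hit-index<m w))
    centre-and-hits-injective {fsuc w} {fzero}   e = contradiction e (≢centre (hit-index<m w))
    centre-and-hits-injective {fsuc w} {fsuc w'} e =
      cong fsuc (hit-index-injective (injective (hit-index<m w) (hit-index<m w') e))

    in-centrePart : ∀ i → P (centre-and-hits i) ≡ P v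
    in-centrePart fzero    = refl
    in-centrePart (fsuc w) = proj₂ (proj₂ (proj₂ (hit w)))

    centrePart-large : suc c ≤ interSize P Q (P v) b
    centrePart-large = injection⇒≤interSize P Q (P v) b centre-and-hits
      centre-and-hits-injective in-centrePart (λ i → Q-constant (centre-and-hits i))

lemma10 : (c n : ℕ) (F : Graph n) (v₁ : Fin n) →
          IsFanWithCentre F v₁ →
          c * c + c + 1 ≤ n →
          (P Q : Partition n) →
          IsTreePartition F P →
          (∀ a b → interSize P Q a b ≤ c) →
          Σ (Fin n) λ v₂ → (v₂ ≢ v₁) × (Q v₂ ≢ Q v₁)
lemma10 c n F v₁ fan size P Q tree small
  with any? (λ x → ¬? (x ≟ v₁) ×-dec ¬? (Q x ≟ Q v₁)) | fan⇒neighbourhoodPath {G = F} fan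
... | yes (v₂ , v₂≢v₁ , differ) | _ = v₂ , v₂≢v₁ , differ
... | no none | m , m+1≡n , path =
  contradiction c[c+1]≤m (<⇒≱ (neighbourhoodPath-short {c = c} P Q (Q v₁) tree Q-constant
                                 (λ a → small a (Q v₁)) path))
  where
  Q-constant : ∀ x → Q x ≡ Q v₁
  Q-constant x = decidable-stable (Q x ≟ Q v₁)
    (λ differ → none (x , (λ x≡v₁ → differ (cong Q x≡v₁)) , differ))

  c[c+1]≤m : c * suc c ≤ m
  c[c+1]≤m = begin
    c * suc c   ≡⟨ *-suc c c ⟩
    c + c * c   ≡⟨ +-comm c (c * c) ⟩
    c * c + c   ≤⟨ +-cancelʳ-≤ 1 (c * c + c) m (subst (c * c + c + 1 ≤_) (≡-sym m+1≡n) size) ⟩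
    m           ∎
    where open ≤-Reasoning
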